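{- For all positive integers $k\le n$ there exist $n$ points $p_1,\dots,p_n\in\{0,1\}^n$ such that for every subset $I\subseteq\{1,\dots,n\}$ with $|I|=k$ there exists $q_I\in\{0,1\}^n$ with Hamming distance \[ \|p_i-q_I\|_1=\begin{cases}k-1 & \text{if } i\in I,\\ k+1 & \text{if } i\notin I.\end{cases} \] Consequently, for $c<1+2/(k-1)$, the only valid answer to the $(c,k)$-NN query $q_I$ on $\{p_1,\dots,p_n\}$ in Hamming space is $\{p_i:i\in I\}$.
   Context: $\|x-y\|_1$ for $x,y\in\{0,1\}^n$ is the Hamming distance (number of differing coordinates). $(c,k)$-NN: a valid answer to query $q$ is a set of $k$ points each at distance at most $c$ times the distance from $q$ to its $k$-th nearest neighbor.
   Formalization: The approximation factor c of the (c,k)-NN query ranges over the rationals. -}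

module Defs where

open import Data.Nat using (ℕ; zero; suc; _∸_; _+_)
open import Data.Nat.Properties using (≤-decTotalOrder)
open import Data.Bool using (Bool; true; false; _xor_)
open import Data.Fin using (Fin)
open import Data.Fin.Subset using (Subset; _∈_; ∣_∣)
open import Data.List using (List; []; _∷_; map; allFin)
open import Data.Nat.ListAction using (sum)
open import Data.Integer using (+_)
open import Data.Rational using (ℚ; _/_; 1ℚ; _≤_; _<_; _*_)
  renaming (_+_ to _+ℚ_)
open import Data.Unit using (⊤)
open import Data.Product using (_×_)
open import Relation.Binary.PropositionalEquality using (_≡_)
import Data.List.Sort as Sort
open Sort ≤-decTotalOrder using (sort)

Point : ℕ → Set
Point n = Fin n → Bool

hamming : {n : ℕ} → Point n → Point n → ℕ
hamming {n} x y = sum (map (λ i → if x i xor y i then 1 else 0) (allFin n))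
  where open import Data.Bool using (if_then_else_)

ℕ→ℚ : ℕ → ℚ
ℕ→ℚ m = + m / 1

-- k-th element (1-indexed) of a list; 0 if out of range (never used so, as k ≤ n).
kth : ℕ → List ℕ → ℕ
kth _             []       = 0
kth zero          (x ∷ _)  = x   -- not used (k ≥ 1)
kth (suc zero)    (x ∷ _)  = x
kth (suc (suc k)) (_ ∷ xs) = kth (suc k) xs

kthNNDist : {n : ℕ} → ℕ → (Fin n → Point n) → Point n → ℕ
kthNNDist {n} k p q = kth k (sort (map (λ i → hamming (p i) q) (allFin n)))

ValidAnswer : {n : ℕ} → ℚ → ℕ → (Fin n → Point n) → Point n → Subset n → Set
ValidAnswer {n} c k p q J =
  (∣ J ∣ ≡ k) ×
  ((j : Fin n) → j ∈ J → ℕ→ℚ (hamming (p j) q) ≤ c * ℕ→ℚ (kthNNDist k p q))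

-- c < 1 + 2/(k-1)  (for k = 1 the bound is +∞, so every c qualifies)
BelowBound : ℕ → ℚ → Set
BelowBound zero          c = ⊤
BelowBound (suc zero)    c = ⊤
BelowBound (suc (suc m)) c = c < 1ℚ +ℚ (+ 2 / suc m)

-- Take p_i = e_i, the i-th unit vector, and q_I = 1_I, the indicator vector of I. Then
-- ‖e_i − 1_I‖₁ = |I| − 1 for i ∈ I and |I| + 1 for i ∉ I, so the distances to q_I take the
-- value k − 1 exactly k times and k + 1 otherwise; the k-th nearest neighbour is at
-- distance k − 1. A point outside I is at distance k + 1 > c (k − 1) whenever c < 1 + 2/(k−1),
-- so a valid answer of size k lies inside I and hence equals I.
module Submission where

open import Defs
open import Data.Nat using (ℕ; zero; suc; _≤_; _∸_; _+_; _*_; s≤s; z≤n)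
import Data.Nat.Properties as ℕ
open import Data.Nat.ListAction using (sum)
open import Data.Nat.Tactic.RingSolver using (solve-∀)
import Data.Integer as ℤ
open import Data.Rational using (ℚ; 1ℚ; _/_; toℚᵘ; NonNegative)
  renaming (_≤_ to _≤ℚ_; _<_ to _<ℚ_; _+_ to _+ℚ_; _*_ to _*ℚ_)
import Data.Rational.Properties as ℚ
open import Data.Rational.Unnormalised using (mkℚᵘ; 1ℚᵘ; *≡*)
  renaming (_+_ to _+ᵘ_; _*_ to _*ᵘ_)
import Data.Rational.Unnormalised.Properties as ℚᵘ
open import Data.Bool using (if_then_else_; _xor_)
open import Data.Fin using (Fin; zero; suc)
open import Data.Fin.Subset using (Subset; _∈_; _∉_; _⊆_; ∣_∣; ⁅_⁆; ⊥; ∁; inside; outside)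
open import Data.Fin.Subset.Properties using (_∈?_; drop-there; drop-∷-⊆; p⊆q⇒∣p∣≤∣q∣)
open import Data.Vec using ([]; _∷_; lookup; here; there)
open import Data.List using (List; _++_; replicate; tabulate; map; allFin)
open import Data.List.Properties using (map-tabulate)
open import Data.List.Relation.Binary.Permutation.Propositional
  using (_↭_; ↭-refl; ↭-prep; ↭-trans; ↭-sym; ↭⇒↭ₛ)
open import Data.List.Relation.Binary.Permutation.Propositional.Properties using (shift)
open import Data.List.Relation.Binary.Pointwise using (Pointwise-≡⇒≡)
open import Data.List.Relation.Unary.Linked using (Linked; []; [-]; _∷_)
open import Data.List.Relation.Unary.Sorted.TotalOrder.Properties using (↗↭↗⇒≋)
open import Data.Product using (Σ; _×_; _,_)
open import Function using (id; _∘_)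
open import Relation.Binary.PropositionalEquality
open import Relation.Nullary using (yes; no; contradiction)
import Data.List.Sort as Sort
open Sort ℕ.≤-decTotalOrder using (sort; sort-↭; sort-↗)

hamming-tabulate : ∀ {n} (x y : Point n) →
  hamming x y ≡ sum (tabulate (λ i → if x i xor y i then 1 else 0))
hamming-tabulate x y = cong sum (map-tabulate id (λ i → if x i xor y i then 1 else 0))

hamming-lookup-∷ : ∀ {n} a b (u v : Subset n) →
  hamming (lookup (a ∷ u)) (lookup (b ∷ v)) ≡ (if a xor b then 1 else 0) + hamming (lookup u) (lookup v)
hamming-lookup-∷ a b u v =
  trans (hamming-tabulate (lookup (a ∷ u)) (lookup (b ∷ v)))
        (cong (_ +_) (sym (hamming-tabulate (lookup u) (lookup v))))

hamming-⊥ : ∀ {n} (p : Subset n) → hamming (lookup ⊥) (lookup p) ≡ ∣ p ∣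
hamming-⊥ []            = refl
hamming-⊥ (inside ∷ p)  = trans (hamming-lookup-∷ outside inside ⊥ p) (cong suc (hamming-⊥ p))
hamming-⊥ (outside ∷ p) = trans (hamming-lookup-∷ outside outside ⊥ p) (hamming-⊥ p)

hamming-⁅⁆-∈ : ∀ {n} {i : Fin n} {p} → i ∈ p → suc (hamming (lookup ⁅ i ⁆) (lookup p)) ≡ ∣ p ∣
hamming-⁅⁆-∈ {p = inside ∷ p} here =
  cong suc (trans (hamming-lookup-∷ inside inside ⊥ p) (hamming-⊥ p))
hamming-⁅⁆-∈ {i = suc i} {inside ∷ p} (there i∈p) =
  cong suc (trans (hamming-lookup-∷ outside inside ⁅ i ⁆ p) (hamming-⁅⁆-∈ i∈p))
hamming-⁅⁆-∈ {i = suc i} {outside ∷ p} (there i∈p) =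
  trans (cong suc (hamming-lookup-∷ outside outside ⁅ i ⁆ p)) (hamming-⁅⁆-∈ i∈p)

hamming-⁅⁆-∉ : ∀ {n} {i : Fin n} {p} → i ∉ p → hamming (lookup ⁅ i ⁆) (lookup p) ≡ suc ∣ p ∣
hamming-⁅⁆-∉ {i = zero}  {inside ∷ p}  i∉p = contradiction here i∉p
hamming-⁅⁆-∉ {i = zero}  {outside ∷ p} _   =
  trans (hamming-lookup-∷ inside outside ⊥ p) (cong suc (hamming-⊥ p))
hamming-⁅⁆-∉ {i = suc i} {inside ∷ p}  i∉p =
  trans (hamming-lookup-∷ outside inside ⁅ i ⁆ p) (cong suc (hamming-⁅⁆-∉ (i∉p ∘ there)))
hamming-⁅⁆-∉ {i = suc i} {outside ∷ p} i∉p =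
  trans (hamming-lookup-∷ outside outside ⁅ i ⁆ p) (hamming-⁅⁆-∉ (i∉p ∘ there))

⊆∧∣∣≡⇒≡ : ∀ {n} {p q : Subset n} → p ⊆ q → ∣ p ∣ ≡ ∣ q ∣ → p ≡ q
⊆∧∣∣≡⇒≡ {p = []}          {[]}          _   _  = refl
⊆∧∣∣≡⇒≡ {p = inside ∷ p}  {inside ∷ q}  p⊆q eq =
  cong (inside ∷_) (⊆∧∣∣≡⇒≡ (drop-∷-⊆ p⊆q) (ℕ.suc-injective eq))
⊆∧∣∣≡⇒≡ {p = inside ∷ p}  {outside ∷ q} p⊆q _  = contradiction (p⊆q here) λ ()
⊆∧∣∣≡⇒≡ {p = outside ∷ p} {inside ∷ q}  p⊆q eq =
  contradiction (subst (_≤ ∣ q ∣) eq (p⊆q⇒∣p∣≤∣q∣ (drop-∷-⊆ p⊆q))) (ℕ.n≮n ∣ q ∣)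
⊆∧∣∣≡⇒≡ {p = outside ∷ p} {outside ∷ q} p⊆q eq =
  cong (outside ∷_) (⊆∧∣∣≡⇒≡ (drop-∷-⊆ p⊆q) eq)

tabulate-↭-replicate : ∀ {n} (I : Subset n) {g : Fin n → ℕ} {a b} →
  (∀ {i} → i ∈ I → g i ≡ a) → (∀ {i} → i ∉ I → g i ≡ b) →
  tabulate g ↭ replicate (∣ I ∣) a ++ replicate (∣ ∁ I ∣) b
tabulate-↭-replicate []           _   _   = ↭-refl
tabulate-↭-replicate (inside ∷ I) {a = a} g∈ g∉ rewrite g∈ here =
  ↭-prep a (tabulate-↭-replicate I (g∈ ∘ there) (g∉ ∘ (_∘ drop-there)))
tabulate-↭-replicate (outside ∷ I) {a = a} {b} g∈ g∉ rewrite g∉ {zero} (λ ()) =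
  ↭-trans (↭-prep b (tabulate-↭-replicate I (g∈ ∘ there) (g∉ ∘ (_∘ drop-there))))
          (↭-sym (shift b (replicate (∣ I ∣) a) (replicate (∣ ∁ I ∣) b)))

replicate-++-replicate-↗ : ∀ {a b} → a ≤ b → ∀ m r → Linked _≤_ (replicate m a ++ replicate r b)
replicate-++-replicate-↗ a≤b zero          zero          = []
replicate-++-replicate-↗ a≤b zero          (suc zero)    = [-]
replicate-++-replicate-↗ a≤b zero          (suc (suc r)) = ℕ.≤-refl ∷ replicate-++-replicate-↗ a≤b zero (suc r)
replicate-++-replicate-↗ a≤b (suc zero)    zero          = [-]
replicate-++-replicate-↗ a≤b (suc zero)    (suc r)       = a≤b ∷ replicate-++-replicate-↗ a≤b zero (suc r)
replicate-++-replicate-↗ a≤b (suc (suc m)) r             = ℕ.≤-refl ∷ replicate-++-replicate-↗ a≤b (suc m) r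

sort-unique : ∀ {xs ys : List ℕ} → xs ↭ ys → Linked _≤_ ys → sort xs ≡ ys
sort-unique {xs} xs↭ys ys↗ =
  Pointwise-≡⇒≡ (↗↭↗⇒≋ ℕ.≤-totalOrder (sort-↗ xs) ys↗ (↭⇒↭ₛ (↭-trans (sort-↭ xs) xs↭ys)))

kth-replicate-++ : ∀ k a (xs : List ℕ) → kth (suc k) (replicate (suc k) a ++ xs) ≡ a
kth-replicate-++ zero    a xs = refl
kth-replicate-++ (suc k) a xs = kth-replicate-++ k a xs

p≤q*p : ∀ p {q} .{{_ : NonNegative p}} → 1ℚ ≤ℚ q → p ≤ℚ q *ℚ p
p≤q*p p {q} 1≤q = subst (_≤ℚ q *ℚ p) (ℚ.*-identityˡ p) (ℚ.*-monoʳ-≤-nonNeg p 1≤q)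

-- Computed in ℚᵘ, where no normalisation by gcd gets in the way.
one+2/sm*sm≡ssm+1 : ∀ m → (1ℚ +ℚ ℤ.+ 2 / suc m) *ℚ ℕ→ℚ (suc m) ≡ ℕ→ℚ (suc (suc m) + 1)
one+2/sm*sm≡ssm+1 m = ℚ.toℚᵘ-injective (begin
  toℚᵘ ((1ℚ +ℚ 2/sm) *ℚ ℕ→ℚ (suc m))          ≈⟨ ℚ.toℚᵘ-homo-* (1ℚ +ℚ 2/sm) (ℕ→ℚ (suc m)) ⟩
  toℚᵘ (1ℚ +ℚ 2/sm) *ᵘ toℚᵘ (ℕ→ℚ (suc m))     ≈⟨ ℚᵘ.*-cong (ℚᵘ.≃-trans (ℚ.toℚᵘ-homo-+ 1ℚ 2/sm)
                                                      (ℚᵘ.+-congʳ 1ℚᵘ (ℚ.toℚᵘ-fromℚᵘ (mkℚᵘ (ℤ.+ 2) m))))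
                                                    (ℚ.toℚᵘ-fromℚᵘ (mkℚᵘ (ℤ.+ suc m) 0)) ⟩
  (1ℚᵘ +ᵘ mkℚᵘ (ℤ.+ 2) m) *ᵘ mkℚᵘ (ℤ.+ suc m) 0 ≈⟨ *≡* (cong ℤ.+[1+_] (cross-multiplied m)) ⟩
  mkℚᵘ (ℤ.+ (suc (suc m) + 1)) 0               ≈⟨ ℚᵘ.≃-sym (ℚ.toℚᵘ-fromℚᵘ (mkℚᵘ (ℤ.+ (suc (suc m) + 1)) 0)) ⟩
  toℚᵘ (ℕ→ℚ (suc (suc m) + 1))                 ∎)
  where
  open ℚᵘ.≃-Reasoning
  2/sm : ℚ
  2/sm = ℤ.+ 2 / suc m
  -- the ℕ identity to which ℚᵘ equality of the two sides unfolds
  cross-multiplied : ∀ m → (m + (m + 0 * suc m + 2) * suc m) * 1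
                         ≡ (m + 0 * suc m) * 1 + suc (m + 1) * suc ((m + 0 * suc m) * 1)
  cross-multiplied = solve-∀

belowBound⇒*< : ∀ k {c} → BelowBound (suc k) c → c *ℚ ℕ→ℚ k <ℚ ℕ→ℚ (suc k + 1)
belowBound⇒*< zero    {c} _ = subst (_<ℚ ℕ→ℚ 2) (sym (ℚ.*-zeroʳ c)) (ℚ.positive⁻¹ (ℕ→ℚ 2))
belowBound⇒*< (suc m) {c} c<bound = begin-strict
  c *ℚ ℕ→ℚ (suc m)                          <⟨ ℚ.*-monoˡ-<-pos (ℕ→ℚ (suc m)) {{ℚ.normalize-pos (suc m) 1}} c<bound ⟩
  (1ℚ +ℚ ℤ.+ 2 / suc m) *ℚ ℕ→ℚ (suc m)      ≡⟨ one+2/sm*sm≡ssm+1 m ⟩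
  ℕ→ℚ (suc (suc m) + 1)                     ∎
  where open ℚ.≤-Reasoning

record Separated {n} (p : Fin n → Point n) (q : Point n) (I : Subset n) (a b : ℕ) : Set where
  field
    inside-dist  : ∀ {i} → i ∈ I → hamming (p i) q ≡ a
    outside-dist : ∀ {i} → i ∉ I → hamming (p i) q ≡ b

module _ {n} {p : Fin n → Point n} {q : Point n} {I : Subset n} {a b : ℕ}
         (sep : Separated p q I a b) where
  open Separated sep

  Separated⇒kthNNDist : ∀ {k} → ∣ I ∣ ≡ suc k → a ≤ b → kthNNDist (suc k) p q ≡ a
  Separated⇒kthNNDist {k} |I| a≤b = begin
    kth (suc k) (sort (map d (allFin n)))
      ≡⟨ cong (kth (suc k) ∘ sort) (map-tabulate id d) ⟩
    kth (suc k) (sort (tabulate d))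
      ≡⟨ cong (kth (suc k)) (sort-unique (tabulate-↭-replicate I inside-dist outside-dist)
                                         (replicate-++-replicate-↗ a≤b ∣ I ∣ ∣ ∁ I ∣)) ⟩
    kth (suc k) (replicate (∣ I ∣) a ++ rest)
      ≡⟨ cong (λ m → kth (suc k) (replicate m a ++ rest)) |I| ⟩
    kth (suc k) (replicate (suc k) a ++ rest)
      ≡⟨ kth-replicate-++ k a rest ⟩
    a ∎
    where
    open ≡-Reasoning
    d : Fin n → ℕ
    d i = hamming (p i) q
    rest : List ℕ
    rest = replicate (∣ ∁ I ∣) b

  Separated⇒uniqueAnswer : ∀ {k c} → ∣ I ∣ ≡ suc k → a ≤ b → c *ℚ ℕ→ℚ a <ℚ ℕ→ℚ b →
    ∀ J → ValidAnswer c (suc k) p q J → J ≡ I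
  Separated⇒uniqueAnswer {k} {c} |I| a≤b ca<b J (|J| , close) = ⊆∧∣∣≡⇒≡ J⊆I (trans |J| (sym |I|))
    where
    J⊆I : J ⊆ I
    J⊆I {j} j∈J with j ∈? I
    ... | yes j∈I = j∈I
    ... | no  j∉I = contradiction (ℚ.≤-<-trans b≤ca ca<b) (ℚ.<-irrefl refl)
      where
      b≤ca : ℕ→ℚ b ≤ℚ c *ℚ ℕ→ℚ a
      b≤ca = subst₂ (λ x y → ℕ→ℚ x ≤ℚ c *ℚ ℕ→ℚ y)
               (outside-dist j∉I) (Separated⇒kthNNDist |I| a≤b) (close j j∈J)

  Separated⇒validAnswer : ∀ {k c} → ∣ I ∣ ≡ suc k → a ≤ b → 1ℚ ≤ℚ c → ValidAnswer c (suc k) p q I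
  Separated⇒validAnswer {k} {c} |I| a≤b 1≤c = |I| , λ i i∈I →
    subst₂ (λ x y → ℕ→ℚ x ≤ℚ c *ℚ ℕ→ℚ y)
      (sym (inside-dist i∈I)) (sym (Separated⇒kthNNDist |I| a≤b))
      (p≤q*p (ℕ→ℚ a) {{ℚ.normalize-nonNeg a 1}} 1≤c)

unitPoints-separated : ∀ {n k} (I : Subset n) → ∣ I ∣ ≡ suc k →
  Separated (λ i → lookup ⁅ i ⁆) (lookup I) I k (suc k + 1)
unitPoints-separated {k = k} I |I| = record
  { inside-dist  = λ i∈I → ℕ.suc-injective (trans (hamming-⁅⁆-∈ i∈I) |I|)
  ; outside-dist = λ i∉I → trans (hamming-⁅⁆-∉ i∉I) (trans (cong suc |I|) (ℕ.+-comm 1 (suc k)))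
  }

mainTheorem10 : (n k : ℕ) → 1 ≤ k → k ≤ n →
    Σ (Fin n → Point n) λ p →
      (I : Subset n) → ∣ I ∣ ≡ k →
        Σ (Point n) λ q →
          ((i : Fin n) → (i ∈ I → hamming (p i) q ≡ k ∸ 1)
                       × (i ∉ I → hamming (p i) q ≡ k + 1))
          × ((c : ℚ) → BelowBound k c →
               (J : Subset n) → ValidAnswer c k p q J → J ≡ I)
          × ((c : ℚ) → 1ℚ ≤ℚ c → ValidAnswer c k p q I)
mainTheorem10 n (suc k) (s≤s z≤n) _ = (λ i → lookup ⁅ i ⁆) , λ I |I| →
  let sep = unitPoints-separated I |I|
  in lookup I
   , (λ i → Separated.inside-dist sep , Separated.outside-dist sep)
   , (λ c below → Separated⇒uniqueAnswer sep {c = c} |I| k≤k+2 (belowBound⇒*< k below))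
   , (λ c 1≤c → Separated⇒validAnswer sep |I| k≤k+2 1≤c)
  where
  k≤k+2 : k ≤ suc k + 1
  k≤k+2 = ℕ.≤-trans (ℕ.n≤1+n k) (ℕ.m≤m+n (suc k) 1)
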